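{- Let $r, s$ be nonzero integers with $r > 0$ and $\gcd(r,s)=1$, and let $n \ge 2$. For nonzero integers $(q_1, \dots, q_n)$ with $\gcd(q_1 q_2 \cdots q_n, s) = 1$, the following are equivalent: (1) $(q_1,\dots,q_n)$ satisfies the cyclic system of congruences $$ r\left(\frac{\prod_{k=1}^n q_k}{q_i}\right) \equiv s \pmod{|q_i|}, \qquad 1 \le i \le n; $$ (2) $(q_1,\dots,q_n)$ satisfies the Diophantine equation $$ r\left(\frac{1}{q_1} + \cdots + \frac{1}{q_n}\right) - \frac{s}{q_1 q_2 \cdots q_n} = m $$ for some integer $m$. -}

module Defs where

open import Data.Nat using (ℕ; suc)
open import Data.Integer using (ℤ; +_; -[1+_]; +[1+_]; -1ℤ)
import Data.Integer as ℤ
open import Data.Fin using (Fin; _≟_)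
open import Data.Vec.Functional using (foldr)
open import Data.Rational using (ℚ; 0ℚ; _/_)
import Data.Rational as ℚ
open import Relation.Nullary using (yes; no)

∏ : ∀ {n} → (Fin n → ℤ) → ℤ
∏ q = foldr ℤ._*_ (+ 1) q

-- product of all q j with j ≠ i  (i.e. (∏ q) / q i, computed exactly)
∏-except : ∀ {n} → Fin n → (Fin n → ℤ) → ℤ
∏-except i q = ∏ (λ j → pick j)
  where
  pick : _ → ℤ
  pick j with j ≟ i
  ... | yes _ = + 1
  ... | no  _ = q j

Σℚ : ∀ {n} → (Fin n → ℚ) → ℚ
Σℚ x = foldr ℚ._+_ 0ℚ x

⟦_⟧ : ℤ → ℚ
⟦ a ⟧ = a / 1

-- reciprocal 1/q of an integer q as a rational (only used for q ≠ 0;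
-- the value at 0 is an arbitrary convention)
inv : ℤ → ℚ
inv (+ 0)      = 0ℚ
inv +[1+ k ]   = + 1 / suc k
inv -[1+ k ]   = -1ℤ / suc k

-- Multiplying the left-hand side of (2) by P = q₁⋯qₙ clears its denominators:
-- it equals N / P with N = r·Σᵢ ∏_{j≠i} q_j − s, so (2) says P ∣ N.  Modulo q_i
-- every summand of N except r·∏_{j≠i} q_j vanishes, so (1) says q_i ∣ N for all i.
-- A common divisor of q_i and q_j (i ≠ j) divides ∏_{k≠i} q_k, hence by (1) also
-- s, and it divides P; as gcd(P, s) = 1 the q_i are pairwise coprime, so they all
-- divide N iff P does.
module Submission where

open import Defs
open import Data.Nat using (ℕ; _≥_)
open import Data.Integer using (ℤ; +_; _>_; _*_; _-_; ∣_∣; 0ℤ)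
open import Data.Integer.Divisibility using (_∣_)
open import Data.Integer.GCD using (gcd)
open import Data.Fin using (Fin)
open import Data.Product using (∃)
open import Relation.Binary.PropositionalEquality using (_≡_; _≢_)
open import Function.Bundles using (_⇔_)
import Data.Rational as ℚ

open import Data.Nat using (zero; suc)
import Data.Nat as ℕ
import Data.Nat.Properties as ℕP
import Data.Nat.Divisibility as ℕD
import Data.Nat.Coprimality as ℕC
import Data.Nat.GCD as ℕG
open import Data.Nat.LCM using (lcm; lcm-least; gcd*lcm)
open import Data.Integer using (-[1+_]; +[1+_]; -1ℤ; 1ℤ)
import Data.Integer as ℤ
import Data.Integer.Properties as ℤP
open import Data.Integer.Coprimality using (Coprime)
import Data.Integer.Divisibility.Signed as Signed
open Signed using () renaming (_∣_ to _∣ˢ_)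
open import Data.Integer.GCD using (gcd-zeroˡ; gcd-zeroʳ)
open import Data.Integer.Tactic.RingSolver using (solve-∀)
open import Data.Rational using (ℚ; 1ℚ; _/_; ↥_; ↧_; ↧ₙ_)
import Data.Rational.Properties as ℚP
import Data.Rational.Unnormalised as ℚᵘ
open import Data.Rational.Solver using (module +-*-Solver)
open import Data.Fin using (zero; suc; _≟_)
open import Data.Fin.Properties using (suc-injective)
open import Data.Vec.Functional using (foldr)
open import Data.Product using (_,_)
open import Data.Sum using (inj₁; inj₂)
open import Data.Empty using (⊥-elim)
open import Relation.Nullary using (yes; no)
open import Relation.Binary.PropositionalEquality using (refl; sym; trans; ≢-sym; cong; cong₂; subst; module ≡-Reasoning)
open import Function using (_∘_)
open import Function.Bundles using (mk⇔; module Equivalence)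
open import Function.Properties.Equivalence using (⇔-setoid) renaming (sym to ⇔-sym)
open import Level using (0ℓ)

↥-/-coprime : ∀ i n .{{_ : ℕ.NonZero n}} → gcd i (+ n) ≡ 1ℤ → ↥ (i / n) ≡ i
↥-/-coprime i n gcd≡1 = begin
  ↥ (i / n)                    ≡⟨ sym (ℤP.*-identityʳ (↥ (i / n))) ⟩
  ↥ (i / n) ℤ.* 1ℤ             ≡⟨ cong (↥ (i / n) ℤ.*_) (sym gcd≡1) ⟩
  ↥ (i / n) ℤ.* gcd i (+ n)    ≡⟨ ℚP.↥-/ i n ⟩
  i                            ∎
  where open ≡-Reasoning

↧ₙ-/-coprime : ∀ i n .{{_ : ℕ.NonZero n}} → gcd i (+ n) ≡ 1ℤ → ↧ₙ (i / n) ≡ n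
↧ₙ-/-coprime i n gcd≡1 = cong ℤ.∣_∣ (begin
  ↧ (i / n)                    ≡⟨ sym (ℤP.*-identityʳ (↧ (i / n))) ⟩
  ↧ (i / n) ℤ.* 1ℤ             ≡⟨ cong (↧ (i / n) ℤ.*_) (sym gcd≡1) ⟩
  ↧ (i / n) ℤ.* gcd i (+ n)    ≡⟨ ℚP.↧-/ i n ⟩
  + n                          ∎)
  where open ≡-Reasoning

↥⟦⟧ : ∀ a → ↥ ⟦ a ⟧ ≡ a
↥⟦⟧ a = ↥-/-coprime a 1 (gcd-zeroʳ a)

↧ₙ⟦⟧ : ∀ a → ↧ₙ ⟦ a ⟧ ≡ 1
↧ₙ⟦⟧ a = ↧ₙ-/-coprime a 1 (gcd-zeroʳ a)

⟦⟧-injective : ∀ {a b} → ⟦ a ⟧ ≡ ⟦ b ⟧ → a ≡ b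
⟦⟧-injective {a} {b} eq = trans (sym (↥⟦⟧ a)) (trans (cong ↥_ eq) (↥⟦⟧ b))

-- ℚ's `_+_` and `_*_` match on record patterns, so they compute only on
-- constructor applications.
+-unfold : ∀ p q → p ℚ.+ q ≡ (↥ p ℤ.* ↧ q ℤ.+ ↥ q ℤ.* ↧ p) / (↧ₙ p ℕ.* ↧ₙ q)
+-unfold (ℚ.mkℚ _ _ _) (ℚ.mkℚ _ _ _) = refl

*-unfold : ∀ p q → p ℚ.* q ≡ (↥ p ℤ.* ↥ q) / (↧ₙ p ℕ.* ↧ₙ q)
*-unfold (ℚ.mkℚ _ _ _) (ℚ.mkℚ _ _ _) = refl

⟦⟧-homo-+ : ∀ a b → ⟦ a ℤ.+ b ⟧ ≡ ⟦ a ⟧ ℚ.+ ⟦ b ⟧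
⟦⟧-homo-+ a b = sym (trans (+-unfold ⟦ a ⟧ ⟦ b ⟧)
  (ℚP./-cong (cong₂ ℤ._+_ (cancel a b) (cancel b a)) (cong₂ ℕ._*_ (↧ₙ⟦⟧ a) (↧ₙ⟦⟧ b))))
  where
  cancel : ∀ x y → ↥ ⟦ x ⟧ ℤ.* ↧ ⟦ y ⟧ ≡ x
  cancel x y = trans (cong₂ ℤ._*_ (↥⟦⟧ x) (cong +_ (↧ₙ⟦⟧ y))) (ℤP.*-identityʳ x)

⟦⟧-homo-* : ∀ a b → ⟦ a ℤ.* b ⟧ ≡ ⟦ a ⟧ ℚ.* ⟦ b ⟧
⟦⟧-homo-* a b = sym (trans (*-unfold ⟦ a ⟧ ⟦ b ⟧)
  (ℚP./-cong (cong₂ ℤ._*_ (↥⟦⟧ a) (↥⟦⟧ b)) (cong₂ ℕ._*_ (↧ₙ⟦⟧ a) (↧ₙ⟦⟧ b))))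

⟦⟧-homo-neg : ∀ a → ⟦ ℤ.- a ⟧ ≡ ℚ.- ⟦ a ⟧
⟦⟧-homo-neg a = sym (trans (sym (ℚP.↥p/↧p≡p (ℚ.- ⟦ a ⟧)))
  (ℚP./-cong (trans (ℚP.↥-neg ⟦ a ⟧) (cong ℤ.-_ (↥⟦⟧ a)))
             (trans (cong ℤ.∣_∣ (ℚP.↧-neg ⟦ a ⟧)) (↧ₙ⟦⟧ a))))

⟦⟧-homo-minus : ∀ a b → ⟦ a ℤ.- b ⟧ ≡ ⟦ a ⟧ ℚ.- ⟦ b ⟧
⟦⟧-homo-minus a b = trans (⟦⟧-homo-+ a (ℤ.- b)) (cong (⟦ a ⟧ ℚ.+_) (⟦⟧-homo-neg b))

n/n≡1 : ∀ n .{{_ : ℕ.NonZero n}} → (+ n) / n ≡ 1ℚ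
-- `i / suc k` is `fromℚᵘ (mkℚᵘ i k)` by definition.
n/n≡1 (suc k) = ℚP.fromℚᵘ-cong {ℚᵘ.mkℚᵘ (+ suc k) k} {ℚᵘ.mkℚᵘ 1ℤ 0}
  (ℚᵘ.*≡* (ℤP.*-comm (+ suc k) 1ℤ))

/-*-⟦⟧ : ∀ i n .{{_ : ℕ.NonZero n}} j → gcd i (+ n) ≡ 1ℤ → (i / n) ℚ.* ⟦ j ⟧ ≡ (i ℤ.* j) / n
/-*-⟦⟧ i n j gcd≡1 = trans (*-unfold (i / n) ⟦ j ⟧)
  (ℚP./-cong (cong₂ ℤ._*_ (↥-/-coprime i n gcd≡1) (↥⟦⟧ j))
             (trans (cong₂ ℕ._*_ (↧ₙ-/-coprime i n gcd≡1) (↧ₙ⟦⟧ j)) (ℕP.*-identityʳ n)))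

inv-*-⟦⟧ : ∀ q → q ≢ 0ℤ → inv q ℚ.* ⟦ q ⟧ ≡ 1ℚ
inv-*-⟦⟧ (+ zero) q≢0 = ⊥-elim (q≢0 refl)
inv-*-⟦⟧ +[1+ k ] _ = trans (/-*-⟦⟧ 1ℤ (suc k) +[1+ k ] (gcd-zeroˡ (+ suc k)))
  (trans (ℚP./-cong (ℤP.*-identityˡ +[1+ k ]) refl) (n/n≡1 (suc k)))
inv-*-⟦⟧ -[1+ k ] _ = trans (/-*-⟦⟧ -1ℤ (suc k) -[1+ k ] (gcd-zeroˡ (+ suc k)))
  (trans (ℚP./-cong (ℤP.-1*i≡-i -[1+ k ]) refl) (n/n≡1 (suc k)))

inv-*-⟦*⟧ : ∀ q e → q ≢ 0ℤ → inv q ℚ.* ⟦ q ℤ.* e ⟧ ≡ ⟦ e ⟧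
inv-*-⟦*⟧ q e q≢0 = begin
  inv q ℚ.* ⟦ q ℤ.* e ⟧          ≡⟨ cong (inv q ℚ.*_) (⟦⟧-homo-* q e) ⟩
  inv q ℚ.* (⟦ q ⟧ ℚ.* ⟦ e ⟧)    ≡⟨ sym (ℚP.*-assoc (inv q) ⟦ q ⟧ ⟦ e ⟧) ⟩
  inv q ℚ.* ⟦ q ⟧ ℚ.* ⟦ e ⟧      ≡⟨ cong (ℚ._* ⟦ e ⟧) (inv-*-⟦⟧ q q≢0) ⟩
  1ℚ ℚ.* ⟦ e ⟧                   ≡⟨ ℚP.*-identityˡ ⟦ e ⟧ ⟩
  ⟦ e ⟧                          ∎
  where open ≡-Reasoning

*-⟦⟧-*-inv : ∀ x q → q ≢ 0ℤ → x ℚ.* ⟦ q ⟧ ℚ.* inv q ≡ x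
*-⟦⟧-*-inv x q q≢0 = begin
  x ℚ.* ⟦ q ⟧ ℚ.* inv q       ≡⟨ ℚP.*-assoc x ⟦ q ⟧ (inv q) ⟩
  x ℚ.* (⟦ q ⟧ ℚ.* inv q)     ≡⟨ cong (x ℚ.*_) (trans (ℚP.*-comm ⟦ q ⟧ (inv q)) (inv-*-⟦⟧ q q≢0)) ⟩
  x ℚ.* 1ℚ                    ≡⟨ ℚP.*-identityʳ x ⟩
  x                           ∎
  where open ≡-Reasoning

∏-cong : ∀ {n} {f g : Fin n → ℤ} → (∀ j → f j ≡ g j) → ∏ f ≡ ∏ g
∏-cong {zero}  f≗g = refl
∏-cong {suc n} f≗g = cong₂ ℤ._*_ (f≗g zero) (∏-cong (f≗g ∘ suc))

∏-extract : ∀ {n} (i : Fin n) (q f : Fin n → ℤ) →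
            f i ≡ 1ℤ → (∀ j → j ≢ i → f j ≡ q j) → ∏ q ≡ q i ℤ.* ∏ f
∏-extract zero q f fi≡1 f≗q = cong (q zero ℤ.*_) (begin
  ∏ (q ∘ suc)             ≡⟨ ∏-cong (λ j → sym (f≗q (suc j) λ ())) ⟩
  ∏ (f ∘ suc)             ≡⟨ sym (ℤP.*-identityˡ (∏ (f ∘ suc))) ⟩
  1ℤ ℤ.* ∏ (f ∘ suc)      ≡⟨ cong (ℤ._* ∏ (f ∘ suc)) (sym fi≡1) ⟩
  ∏ f                     ∎)
  where open ≡-Reasoning
∏-extract (suc i) q f fi≡1 f≗q = begin
  q zero ℤ.* ∏ (q ∘ suc)                 ≡⟨ cong (q zero ℤ.*_) ∏-tail ⟩
  q zero ℤ.* (q (suc i) ℤ.* ∏ (f ∘ suc)) ≡⟨ x∙yz≈y∙xz (q zero) (q (suc i)) (∏ (f ∘ suc)) ⟩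
  q (suc i) ℤ.* (q zero ℤ.* ∏ (f ∘ suc)) ≡⟨ cong (λ x → q (suc i) ℤ.* (x ℤ.* ∏ (f ∘ suc))) (sym f₀≡q₀) ⟩
  q (suc i) ℤ.* ∏ f                      ∎
  where
  open ≡-Reasoning
  f₀≡q₀ : f zero ≡ q zero
  f₀≡q₀ = f≗q zero λ ()
  ∏-tail : ∏ (q ∘ suc) ≡ q (suc i) ℤ.* ∏ (f ∘ suc)
  ∏-tail = ∏-extract i (q ∘ suc) (f ∘ suc) fi≡1 (λ j j≢i → f≗q (suc j) (j≢i ∘ suc-injective))
  open import Algebra.Properties.CommutativeSemigroup ℤP.*-commutativeSemigroup using (x∙yz≈y∙xz)

∏-factor : ∀ {n} (q : Fin n → ℤ) i → q i ∣ˢ ∏ q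
∏-factor q zero    = Signed.∣m⇒∣m*n (∏ (q ∘ suc)) Signed.∣-refl
∏-factor q (suc i) = Signed.∣n⇒∣m*n (q zero) (∏-factor (q ∘ suc) i)

∏-≢0 : ∀ {n} (q : Fin n → ℤ) → (∀ i → q i ≢ 0ℤ) → ∏ q ≢ 0ℤ
∏-≢0 {zero}  q q≢0 ()
∏-≢0 {suc n} q q≢0 ∏≡0 with ℤP.i*j≡0⇒i≡0∨j≡0 (q zero) ∏≡0
... | inj₁ q₀≡0 = q≢0 zero q₀≡0
... | inj₂ ∏≡0′ = ∏-≢0 (q ∘ suc) (q≢0 ∘ suc) ∏≡0′

-- `∏-except i q` multiplies a function local to the where-block of its
-- definition; unifying with `∏` recovers it.
private
  factors : ∀ {n} {f : Fin n → ℤ} {x} → ∏ f ≡ x → Fin n → ℤ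
  factors {f = f} _ = f

except-factors : ∀ {n} → Fin n → (Fin n → ℤ) → Fin n → ℤ
except-factors i q = factors {x = ∏-except i q} refl

except-factors-self : ∀ {n} (i : Fin n) q → except-factors i q i ≡ 1ℤ
except-factors-self i q with i ≟ i
... | yes _  = refl
... | no i≢i = ⊥-elim (i≢i refl)

except-factors-other : ∀ {n} (i : Fin n) q j → j ≢ i → except-factors i q j ≡ q j
except-factors-other i q j j≢i with j ≟ i
... | yes j≡i = ⊥-elim (j≢i j≡i)
... | no _    = refl

∏≡*∏-except : ∀ {n} (i : Fin n) q → ∏ q ≡ q i ℤ.* ∏-except i q
∏≡*∏-except i q =
  ∏-extract i q (except-factors i q) (except-factors-self i q) (except-factors-other i q)

∣∏-except : ∀ {n} {i j : Fin n} q → j ≢ i → q j ∣ˢ ∏-except i q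
∣∏-except {i = i} {j} q j≢i =
  subst (_∣ˢ ∏-except i q) (except-factors-other i q j j≢i) (∏-factor (except-factors i q) j)

Σℤ : ∀ {n} → (Fin n → ℤ) → ℤ
Σℤ = foldr ℤ._+_ 0ℤ

∣Σℤ : ∀ {n} {a} (g : Fin n → ℤ) → (∀ j → a ∣ˢ g j) → a ∣ˢ Σℤ g
∣Σℤ {zero}  g a∣g = Signed.divides 0ℤ refl
∣Σℤ {suc n} g a∣g = Signed.∣m∣n⇒∣m+n (a∣g zero) (∣Σℤ (g ∘ suc) (a∣g ∘ suc))

∣Σℤ-minus-term : ∀ {n} {a} (g : Fin n → ℤ) i → (∀ j → j ≢ i → a ∣ˢ g j) → a ∣ˢ Σℤ g ℤ.- g i
∣Σℤ-minus-term {a = a} g zero a∣g = subst (a ∣ˢ_) (sym (m+n-m≡n (g zero) (Σℤ (g ∘ suc))))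
  (∣Σℤ (g ∘ suc) (λ j → a∣g (suc j) λ ()))
  where
  m+n-m≡n : ∀ m n → m ℤ.+ n ℤ.- m ≡ n
  m+n-m≡n = solve-∀
∣Σℤ-minus-term {a = a} g (suc i) a∣g =
  subst (a ∣ˢ_) (sym (ℤP.+-assoc (g zero) (Σℤ (g ∘ suc)) (ℤ.- g (suc i))))
    (Signed.∣m∣n⇒∣m+n (a∣g zero λ ())
      (∣Σℤ-minus-term (g ∘ suc) i (λ j j≢i → a∣g (suc j) (j≢i ∘ suc-injective))))

Σℚ-cong : ∀ {n} {f g : Fin n → ℚ} → (∀ j → f j ≡ g j) → Σℚ f ≡ Σℚ g
Σℚ-cong {zero}  f≗g = refl
Σℚ-cong {suc n} f≗g = cong₂ ℚ._+_ (f≗g zero) (Σℚ-cong (f≗g ∘ suc))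

Σℚ-*-distribʳ : ∀ {n} (f : Fin n → ℚ) c → Σℚ f ℚ.* c ≡ Σℚ (λ i → f i ℚ.* c)
Σℚ-*-distribʳ {zero}  f c = ℚP.*-zeroˡ c
Σℚ-*-distribʳ {suc n} f c = trans (ℚP.*-distribʳ-+ c (f zero) (Σℚ (f ∘ suc)))
  (cong (f zero ℚ.* c ℚ.+_) (Σℚ-*-distribʳ (f ∘ suc) c))

⟦⟧-homo-Σ : ∀ {n} (g : Fin n → ℤ) → ⟦ Σℤ g ⟧ ≡ Σℚ (λ i → ⟦ g i ⟧)
⟦⟧-homo-Σ {zero}  g = refl
⟦⟧-homo-Σ {suc n} g = trans (⟦⟧-homo-+ (g zero) (Σℤ (g ∘ suc)))
  (cong (⟦ g zero ⟧ ℚ.+_) (⟦⟧-homo-Σ (g ∘ suc)))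

coprime-*ʳ : ∀ {a b c} → ℕC.Coprime a b → ℕC.Coprime a c → ℕC.Coprime a (b ℕ.* c)
coprime-*ʳ a⊥b a⊥c (d∣a , d∣bc) = a⊥c (d∣a , ℕC.coprime-divisor d⊥b d∣bc)
  where
  d⊥b : ℕC.Coprime _ _
  d⊥b (e∣d , e∣b) = a⊥b (ℕD.∣-trans e∣d d∣a , e∣b)

coprime-*-∣ : ∀ {a b c} → ℕC.Coprime a b → a ℕD.∣ c → b ℕD.∣ c → a ℕ.* b ℕD.∣ c
coprime-*-∣ {a} {b} a⊥b a∣c b∣c = subst (ℕD._∣ _) lcm≡* (lcm-least a∣c b∣c)
  where
  open ≡-Reasoning
  lcm≡* : lcm a b ≡ a ℕ.* b
  lcm≡* = begin
    lcm a b                 ≡⟨ sym (ℕP.*-identityˡ (lcm a b)) ⟩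
    1 ℕ.* lcm a b           ≡⟨ cong (ℕ._* lcm a b) (sym (ℕC.coprime⇒gcd≡1 a⊥b)) ⟩
    ℕG.gcd a b ℕ.* lcm a b  ≡⟨ gcd*lcm a b ⟩
    a ℕ.* b                 ∎

coprime-∏ : ∀ {n} a (q : Fin n → ℤ) → (∀ j → Coprime a (q j)) → Coprime a (∏ q)
coprime-∏ {zero}  a q a⊥q = ℕC.sym (ℕC.1-coprimeTo ∣ a ∣)
coprime-∏ {suc n} a q a⊥q = subst (ℕC.Coprime ∣ a ∣) (sym (ℤP.abs-* (q zero) (∏ (q ∘ suc))))
  (coprime-*ʳ (a⊥q zero) (coprime-∏ a (q ∘ suc) (a⊥q ∘ suc)))

∏-∣ : ∀ {n} (q : Fin n → ℤ) {N} →
      (∀ i j → i ≢ j → Coprime (q i) (q j)) → (∀ i → q i ∣ N) → ∏ q ∣ N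
∏-∣ {zero}  q _ _ = ℕD.1∣ _
∏-∣ {suc n} q {N} q⊥q q∣N = subst (ℕD._∣ ∣ N ∣) (sym (ℤP.abs-* (q zero) (∏ (q ∘ suc))))
  (coprime-*-∣ (coprime-∏ (q zero) (q ∘ suc) (λ j → q⊥q zero (suc j) λ ())) (q∣N zero) ∏tail∣N)
  where
  ∏tail∣N : ∏ (q ∘ suc) ∣ N
  ∏tail∣N = ∏-∣ (q ∘ suc) {N} (λ i j i≢j → q⊥q (suc i) (suc j) (i≢j ∘ suc-injective)) (q∣N ∘ suc)

module _ (r s : ℤ) {n : ℕ} (q : Fin n → ℤ) where

  numerator : ℤ
  numerator = r ℤ.* Σℤ (λ i → ∏-except i q) ℤ.- s

  lhs : ℚ
  lhs = ⟦ r ⟧ ℚ.* Σℚ (λ i → inv (q i)) ℚ.- ⟦ s ⟧ ℚ.* inv (∏ q)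

  module _ (q≢0 : ∀ i → q i ≢ 0ℤ) where

    Σinv*∏≡Σ∏-except : Σℚ (λ i → inv (q i)) ℚ.* ⟦ ∏ q ⟧ ≡ ⟦ Σℤ (λ i → ∏-except i q) ⟧
    Σinv*∏≡Σ∏-except = begin
      Σℚ (λ i → inv (q i)) ℚ.* ⟦ ∏ q ⟧  ≡⟨ Σℚ-*-distribʳ (λ i → inv (q i)) ⟦ ∏ q ⟧ ⟩
      Σℚ (λ i → inv (q i) ℚ.* ⟦ ∏ q ⟧)  ≡⟨ Σℚ-cong inv-*-∏ ⟩
      Σℚ (λ i → ⟦ ∏-except i q ⟧)       ≡⟨ sym (⟦⟧-homo-Σ (λ i → ∏-except i q)) ⟩
      ⟦ Σℤ (λ i → ∏-except i q) ⟧       ∎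
      where
      open ≡-Reasoning
      inv-*-∏ : ∀ i → inv (q i) ℚ.* ⟦ ∏ q ⟧ ≡ ⟦ ∏-except i q ⟧
      inv-*-∏ i = trans (cong (λ x → inv (q i) ℚ.* ⟦ x ⟧) (∏≡*∏-except i q))
                        (inv-*-⟦*⟧ (q i) (∏-except i q) (q≢0 i))

    lhs*∏≡numerator : lhs ℚ.* ⟦ ∏ q ⟧ ≡ ⟦ numerator ⟧
    lhs*∏≡numerator = begin
      lhs ℚ.* ⟦ ∏ q ⟧
        ≡⟨ distrib ⟦ r ⟧ Σinv ⟦ s ⟧ (inv (∏ q)) ⟦ ∏ q ⟧ ⟩
      ⟦ r ⟧ ℚ.* (Σinv ℚ.* ⟦ ∏ q ⟧) ℚ.- ⟦ s ⟧ ℚ.* (inv (∏ q) ℚ.* ⟦ ∏ q ⟧)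
        ≡⟨ cong₂ (λ x y → ⟦ r ⟧ ℚ.* x ℚ.- ⟦ s ⟧ ℚ.* y)
                 Σinv*∏≡Σ∏-except (inv-*-⟦⟧ (∏ q) (∏-≢0 q q≢0)) ⟩
      ⟦ r ⟧ ℚ.* ⟦ Σ∏-except ⟧ ℚ.- ⟦ s ⟧ ℚ.* 1ℚ
        ≡⟨ cong₂ ℚ._-_ (sym (⟦⟧-homo-* r Σ∏-except)) (ℚP.*-identityʳ ⟦ s ⟧) ⟩
      ⟦ r ℤ.* Σ∏-except ⟧ ℚ.- ⟦ s ⟧
        ≡⟨ sym (⟦⟧-homo-minus (r ℤ.* Σ∏-except) s) ⟩
      ⟦ numerator ⟧
        ∎
      where
      open ≡-Reasoning
      open +-*-Solver using (solve; _:*_; _:-_; _:=_)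
      Σinv = Σℚ (λ i → inv (q i))
      Σ∏-except = Σℤ (λ i → ∏-except i q)
      distrib : ∀ a b c d e → (a ℚ.* b ℚ.- c ℚ.* d) ℚ.* e ≡ a ℚ.* (b ℚ.* e) ℚ.- c ℚ.* (d ℚ.* e)
      distrib = solve 5 (λ a b c d e → (a :* b :- c :* d) :* e := a :* (b :* e) :- c :* (d :* e)) refl

    lhs-integral⇔∏∣numerator : (∃ λ m → lhs ≡ ⟦ m ⟧) ⇔ ∏ q ∣ˢ numerator
    lhs-integral⇔∏∣numerator = mk⇔ to from
      where
      open ≡-Reasoning
      ∏≢0 : ∏ q ≢ 0ℤ
      ∏≢0 = ∏-≢0 q q≢0
      to : (∃ λ m → lhs ≡ ⟦ m ⟧) → ∏ q ∣ˢ numerator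
      to (m , lhs≡m) = Signed.divides m (⟦⟧-injective (begin
        ⟦ numerator ⟧      ≡⟨ sym lhs*∏≡numerator ⟩
        lhs ℚ.* ⟦ ∏ q ⟧    ≡⟨ cong (ℚ._* ⟦ ∏ q ⟧) lhs≡m ⟩
        ⟦ m ⟧ ℚ.* ⟦ ∏ q ⟧  ≡⟨ sym (⟦⟧-homo-* m (∏ q)) ⟩
        ⟦ m ℤ.* ∏ q ⟧      ∎))
      from : ∏ q ∣ˢ numerator → ∃ λ m → lhs ≡ ⟦ m ⟧
      from (Signed.divides k numerator≡k*∏) = k , (begin
        lhs                              ≡⟨ sym (*-⟦⟧-*-inv lhs (∏ q) ∏≢0) ⟩
        lhs ℚ.* ⟦ ∏ q ⟧ ℚ.* inv (∏ q)    ≡⟨ cong (ℚ._* inv (∏ q)) lhs*∏≡⟦k⟧*∏ ⟩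
        ⟦ k ⟧ ℚ.* ⟦ ∏ q ⟧ ℚ.* inv (∏ q)  ≡⟨ *-⟦⟧-*-inv ⟦ k ⟧ (∏ q) ∏≢0 ⟩
        ⟦ k ⟧                            ∎)
        where
        lhs*∏≡⟦k⟧*∏ : lhs ℚ.* ⟦ ∏ q ⟧ ≡ ⟦ k ⟧ ℚ.* ⟦ ∏ q ⟧
        lhs*∏≡⟦k⟧*∏ = trans lhs*∏≡numerator (trans (cong ⟦_⟧ numerator≡k*∏) (⟦⟧-homo-* k (∏ q)))

  congruence⇔∣numerator : ∀ i → q i ∣ˢ r ℤ.* ∏-except i q ℤ.- s ⇔ q i ∣ˢ numerator
  congruence⇔∣numerator i = mk⇔
    (λ qᵢ∣rE-s → subst (q i ∣ˢ_) (add-rest r T E s) (Signed.∣m∣n⇒∣m+n qᵢ∣rE-s qᵢ∣rest))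
    (λ qᵢ∣numerator → subst (q i ∣ˢ_) (remove-rest r T E s) (Signed.∣m∣n⇒∣m-n qᵢ∣numerator qᵢ∣rest))
    where
    E = ∏-except i q
    T = Σℤ (λ j → ∏-except j q)
    qᵢ∣rest : q i ∣ˢ r ℤ.* (T ℤ.- E)
    qᵢ∣rest = Signed.∣n⇒∣m*n r
      (∣Σℤ-minus-term (λ j → ∏-except j q) i (λ j j≢i → ∣∏-except q (≢-sym j≢i)))
    add-rest : ∀ a t e b → a ℤ.* e ℤ.- b ℤ.+ a ℤ.* (t ℤ.- e) ≡ a ℤ.* t ℤ.- b
    add-rest = solve-∀
    remove-rest : ∀ a t e b → a ℤ.* t ℤ.- b ℤ.- a ℤ.* (t ℤ.- e) ≡ a ℤ.* e ℤ.- b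
    remove-rest = solve-∀

  module _ (gcd[∏q,s]≡1 : gcd (∏ q) s ≡ 1ℤ) where

    pairwise-coprime : (∀ i → q i ∣ˢ numerator) → ∀ i j → i ≢ j → Coprime (q i) (q j)
    pairwise-coprime q∣numerator i j i≢j {d} (d∣qᵢ , d∣qⱼ) =
      ℕC.gcd≡1⇒coprime (cong ∣_∣ gcd[∏q,s]≡1) (Signed.∣⇒∣ᵤ d∣∏q , Signed.∣⇒∣ᵤ d∣s)
      where
      d∣∏q : + d ∣ˢ ∏ q
      d∣∏q = Signed.∣-trans (Signed.∣ᵤ⇒∣ d∣qᵢ) (∏-factor q i)
      d∣rE : + d ∣ˢ r ℤ.* ∏-except i q
      d∣rE = Signed.∣n⇒∣m*n r (Signed.∣-trans (Signed.∣ᵤ⇒∣ d∣qⱼ) (∣∏-except q (≢-sym i≢j)))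
      d∣rE-s : + d ∣ˢ r ℤ.* ∏-except i q ℤ.- s
      d∣rE-s = Signed.∣-trans (Signed.∣ᵤ⇒∣ d∣qᵢ)
                 (Equivalence.from (congruence⇔∣numerator i) (q∣numerator i))
      d∣s : + d ∣ˢ s
      d∣s = subst (+ d ∣ˢ_) (ℤP.neg-involutive s) (Signed.∣m⇒∣-m (Signed.∣m+n∣m⇒∣n d∣rE-s d∣rE))

    all∣⇔∏∣ : (∀ i → q i ∣ˢ numerator) ⇔ ∏ q ∣ˢ numerator
    all∣⇔∏∣ = mk⇔
      (λ q∣N → Signed.∣ᵤ⇒∣ (∏-∣ q {numerator} (pairwise-coprime q∣N) (Signed.∣⇒∣ᵤ ∘ q∣N)))
      (λ ∏q∣N i → Signed.∣-trans (∏-factor q i) ∏q∣N)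

lemma2p1 : (r s : ℤ) → r > 0ℤ → s ≢ 0ℤ → gcd r s ≡ + 1 →
             (n : ℕ) → n ≥ 2 →
             (q : Fin n → ℤ) → (∀ i → q i ≢ 0ℤ) → gcd (∏ q) s ≡ + 1 →
             (∀ i → (+ ∣ q i ∣) ∣ (r * ∏-except i q - s))
             ⇔
             ∃ λ (m : ℤ) → ⟦ r ⟧ ℚ.* Σℚ (λ i → inv (q i)) ℚ.- ⟦ s ⟧ ℚ.* inv (∏ q) ≡ ⟦ m ⟧
lemma2p1 r s _ _ _ _ _ q q≢0 gcd[∏q,s]≡1 = begin
  (∀ i → (+ ∣ q i ∣) ∣ (r * ∏-except i q - s))  ≈⟨ mk⇔ (Signed.∣ᵤ⇒∣ ∘_) (Signed.∣⇒∣ᵤ ∘_) ⟩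
  (∀ i → q i ∣ˢ r * ∏-except i q - s)           ≈⟨ mk⇔ (λ h i → to (congruence i) (h i))
                                                        (λ h i → from (congruence i) (h i)) ⟩
  (∀ i → q i ∣ˢ numerator r s q)                ≈⟨ all∣⇔∏∣ r s q gcd[∏q,s]≡1 ⟩
  ∏ q ∣ˢ numerator r s q                        ≈⟨ ⇔-sym (lhs-integral⇔∏∣numerator r s q q≢0) ⟩
  (∃ λ m → lhs r s q ≡ ⟦ m ⟧)                   ∎
  where
  open import Relation.Binary.Reasoning.Setoid (⇔-setoid 0ℓ)
  open Equivalence using (to; from)
  congruence = congruence⇔∣numerator r s q
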